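{- Let $G$ and $H$ be ambi-nut digraphs with $\operatorname{Ker}G=\langle\mathbf{x}\rangle=\operatorname{CoKer}G$ and $\operatorname{Ker}H=\langle\mathbf{y}\rangle=\operatorname{CoKer}H$. If $u^*\to v^*$ is an arc of $G$ and $s^*\to t^*$ is an arc of $H$ such that $\mathbf{x}(u^*)=\mathbf{y}(s^*)$ and $\mathbf{x}(v^*)=\mathbf{y}(t^*)$, then the cross-over $(G,u^*,v^*)\bowtie(H,s^*,t^*)$ is an ambi-nut digraph.
   Context: A digraph $G$ is a finite nonempty vertex set $V(G)$ with an arbitrary binary relation $\to$. $\operatorname{Ker}G=\{\mathbf{x}\colon V(G)\to\mathbb{R} : \sum_{w: z\to w}\mathbf{x}(w)=0\ \forall z\}$ and $\operatorname{CoKer}G=\{\mathbf{x} : \sum_{w:w\to z}\mathbf{x}(w)=0\ \forall z\}$. A vector is full if it has no zero entry. $G$ is ambi-nut if $\operatorname{Ker}G$ and $\operatorname{CoKer}G$ are both one-dimensional and spanned by the same full vector. For an arc $u\to v$ of $G$ and an arc $s\to t$ of $H$, the cross-over $(G,u,v)\bowtie(H,s,t)$ is obtained from the disjoint union of $G$ and $H$ by deleting the arcs $u\to v$ and $s\to t$ and adding the arcs $u\to t$ and $s\to v$.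
   Formalization: The kernel and cokernel, their spanning vectors $\mathbf{x}$ and $\mathbf{y}$, and all scalars are taken over ℚ instead of ℝ, so the ambi-nut property is likewise defined over ℚ. -}

module Defs where

open import Data.Nat using (ℕ; zero; suc; _≤_; _+_)
open import Data.Fin using (Fin; splitAt; _≟_)
import Data.Fin as F
open import Data.Bool using (Bool; true; false; _∧_; not)
open import Data.Sum using (_⊎_; inj₁; inj₂)
open import Data.Product using (Σ; _×_; ∃)
open import Data.Rational using (ℚ; 0ℚ) renaming (_+_ to _+ℚ_; _*_ to _*ℚ_)
open import Relation.Binary.PropositionalEquality using (_≡_; _≢_)
open import Relation.Nullary.Decidable using (⌊_⌋)

-- A digraph on vertex set Fin n: an arbitrary binary relation, given by
-- its (Boolean) characteristic function.  `G a b ≡ true` means a → b.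
Digraph : ℕ → Set
Digraph n = Fin n → Fin n → Bool

Σᶠ : (n : ℕ) → (Fin n → ℚ) → ℚ
Σᶠ zero    f = 0ℚ
Σᶠ (suc n) f = f F.zero +ℚ Σᶠ n (λ i → f (F.suc i))

mask : Bool → ℚ → ℚ
mask true  q = q
mask false q = 0ℚ

InKer : ∀ {n} → Digraph n → (Fin n → ℚ) → Set
InKer {n} G x = ∀ z → Σᶠ n (λ w → mask (G z w) (x w)) ≡ 0ℚ

InCoKer : ∀ {n} → Digraph n → (Fin n → ℚ) → Set
InCoKer {n} G x = ∀ z → Σᶠ n (λ w → mask (G w z) (x w)) ≡ 0ℚ

InSpan : ∀ {n} → (Fin n → ℚ) → (Fin n → ℚ) → Set
InSpan x z = ∃ λ (c : ℚ) → ∀ i → z i ≡ c *ℚ x i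

SpannedBy : ∀ {n} → ((Fin n → ℚ) → Set) → (Fin n → ℚ) → Set
SpannedBy P x = ∀ z → (P z → InSpan x z) × (InSpan x z → P z)

Full : ∀ {n} → (Fin n → ℚ) → Set
Full x = ∀ i → x i ≢ 0ℚ

-- G is ambi-nut: (nonempty, and) Ker G and CoKer G are both spanned by
-- the same full vector (a full vector on a nonempty set is nonzero, so
-- both spaces are then one-dimensional).
AmbiNut : ∀ {n} → Digraph n → Set
AmbiNut {n} G = (1 ≤ n) × (∃ λ x → Full x × SpannedBy (InKer G) x × SpannedBy (InCoKer G) x)

-- Cross-over (G,u,v) ⋈ (H,s,t) on Fin (n + m): vertices of G are the
-- first n, vertices of H the last m.
crossOver : ∀ {n m} → Digraph n → Fin n → Fin n → Digraph m → Fin m → Fin m → Digraph (n + m)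
crossOver {n} {m} G u v H s t a b = go (splitAt n a) (splitAt n b)
  where
  go : Fin n ⊎ Fin m → Fin n ⊎ Fin m → Bool
  go (inj₁ a) (inj₁ b) = G a b ∧ not (⌊ a ≟ u ⌋ ∧ ⌊ b ≟ v ⌋)
  go (inj₂ a) (inj₂ b) = H a b ∧ not (⌊ a ≟ s ⌋ ∧ ⌊ b ≟ t ⌋)
  go (inj₁ a) (inj₂ b) = ⌊ a ≟ u ⌋ ∧ ⌊ b ≟ t ⌋
  go (inj₂ a) (inj₁ b) = ⌊ a ≟ s ⌋ ∧ ⌊ b ≟ v ⌋

{-# OPTIONS --safe #-}
-- Write K for the cross-over and split a vector on it as w = w₁ ++ w₂.  On the rows of G,
--   (K w)(i) + [i = u] w₁(v) = (G w₁)(i) + [i = u] w₂(t),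
-- and symmetrically on the rows of H.  So whenever w₁(v) = w₂(t), w ∈ Ker K iff w₁ ∈ Ker G and
-- w₂ ∈ Ker H; this covers x ++ y since x(v) = y(t).  Conversely every w ∈ Ker K has w₁(v) = w₂(t):
-- pairing the G-rows with x ∈ CoKer G annihilates the image of G and leaves x(u) w₁(v) = x(u) w₂(t).
-- Then w₁ = c x, w₂ = d y, and c = d because x(v) = y(t) ≠ 0.  For the cokernel, CoKer K = Ker Kᵀ
-- and Kᵀ is the cross-over of Gᵀ and Hᵀ at the reversed arcs v → u and t → s, where x(u) = y(s).
module Submission where

open import Defs
open import Algebra.Bundles using (CommutativeMonoid; CommutativeRing)
open import Data.Bool using (true; false; _∧_; not)
open import Data.Bool.Properties using (∧-comm)
open import Data.Fin using (Fin; zero; suc; _↑ˡ_; _↑ʳ_; splitAt; _≟_)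
open import Data.Fin.Properties using (splitAt-↑ˡ; splitAt-↑ʳ; splitAt⁻¹-↑ˡ; splitAt⁻¹-↑ʳ)
import Data.Nat as ℕ
open import Data.Nat.Properties using (m≤m+n; ≤-trans)
open import Data.Product using (_×_; _,_; proj₁; proj₂)
open import Data.Rational using (ℚ; 0ℚ; 1ℚ; _+_; _*_; 1/_; ≢-nonZero)
open import Data.Rational.Properties
  using (+-assoc; +-identityˡ; +-identityʳ; *-assoc; *-comm; *-identityˡ; *-identityʳ; *-zeroʳ;
         *-inverseʳ; *-distribˡ-+;
         +-0-group; +-0-commutativeMonoid; +-*-commutativeRing)
open import Data.Sum using (inj₁; inj₂)
open import Data.Vec.Functional using (Vector; _++_; take; drop)
open import Data.Vec.Functional.Properties using (lookup-++ˡ; lookup-++ʳ)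
open import Function using (_⇔_; mk⇔; Equivalence)
open import Relation.Binary.PropositionalEquality
open import Relation.Nullary.Decidable using (⌊_⌋; yes; no; ⌊⌋-map′)

open import Algebra.Properties.Semiring.Sum (CommutativeRing.semiring +-*-commutativeRing)
  using (sum; ∑-distrib-+; *-distribˡ-sum; sum-replicate-zero)
open import Algebra.Properties.Group +-0-group using (∙-cancelʳ)
open import Algebra.Properties.CommutativeSemigroup
  (CommutativeMonoid.commutativeSemigroup +-0-commutativeMonoid) using (xy∙z≈xz∙y; xy∙z≈yz∙x)
open ≡-Reasoning

*-cancelʳ-≢0 : ∀ r {p q} → r ≢ 0ℚ → p * r ≡ q * r → p ≡ q
*-cancelʳ-≢0 r {p} {q} r≢0 pr≡qr = begin
  p                ≡⟨ sym (*-identityʳ p) ⟩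
  p * 1ℚ           ≡⟨ cong (p *_) (sym (*-inverseʳ r)) ⟩
  p * (r * 1/ r)   ≡⟨ sym (*-assoc p r _) ⟩
  (p * r) * 1/ r   ≡⟨ cong (_* 1/ r) pr≡qr ⟩
  (q * r) * 1/ r   ≡⟨ *-assoc q r _ ⟩
  q * (r * 1/ r)   ≡⟨ cong (q *_) (*-inverseʳ r) ⟩
  q * 1ℚ           ≡⟨ *-identityʳ q ⟩
  q                ∎
  where instance _ = ≢-nonZero r≢0

↑-elim : ∀ {n m} {P : Fin (n ℕ.+ m) → Set} → (∀ i → P (i ↑ˡ m)) → (∀ j → P (n ↑ʳ j)) → ∀ a → P a
↑-elim {n} {P = P} left right a with splitAt n a in eq
... | inj₁ i = subst P (splitAt⁻¹-↑ˡ eq) (left i)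
... | inj₂ j = subst P (splitAt⁻¹-↑ʳ eq) (right j)

Σᶠ≡sum : ∀ n (f : Vector ℚ n) → Σᶠ n f ≡ sum f
Σᶠ≡sum ℕ.zero    f = refl
Σᶠ≡sum (ℕ.suc n) f = cong (f zero +_) (Σᶠ≡sum n (λ i → f (suc i)))

Σᶠ-cong : ∀ n {f g : Vector ℚ n} → (∀ i → f i ≡ g i) → Σᶠ n f ≡ Σᶠ n g
Σᶠ-cong ℕ.zero    f≗g = refl
Σᶠ-cong (ℕ.suc n) f≗g = cong₂ _+_ (f≗g zero) (Σᶠ-cong n (λ i → f≗g (suc i)))

Σᶠ-zero : ∀ n → Σᶠ n (λ _ → 0ℚ) ≡ 0ℚ
Σᶠ-zero n = trans (Σᶠ≡sum n _) (sum-replicate-zero n)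

Σᶠ-distrib-+ : ∀ n (f g : Vector ℚ n) → Σᶠ n (λ i → f i + g i) ≡ Σᶠ n f + Σᶠ n g
Σᶠ-distrib-+ n f g = begin
  Σᶠ n (λ i → f i + g i)  ≡⟨ Σᶠ≡sum n _ ⟩
  sum (λ i → f i + g i)   ≡⟨ ∑-distrib-+ f g ⟩
  sum f + sum g           ≡⟨ sym (cong₂ _+_ (Σᶠ≡sum n f) (Σᶠ≡sum n g)) ⟩
  Σᶠ n f + Σᶠ n g         ∎

Σᶠ-*ˡ : ∀ n c (f : Vector ℚ n) → Σᶠ n (λ i → c * f i) ≡ c * Σᶠ n f
Σᶠ-*ˡ n c f = begin
  Σᶠ n (λ i → c * f i)  ≡⟨ Σᶠ≡sum n _ ⟩
  sum (λ i → c * f i)   ≡⟨ sym (*-distribˡ-sum c f) ⟩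
  c * sum f             ≡⟨ sym (cong (c *_) (Σᶠ≡sum n f)) ⟩
  c * Σᶠ n f            ∎

Σᶠ-comm : ∀ n m (f : Fin n → Fin m → ℚ) → Σᶠ n (λ i → Σᶠ m (f i)) ≡ Σᶠ m (λ j → Σᶠ n (λ i → f i j))
Σᶠ-comm ℕ.zero    m f = sym (Σᶠ-zero m)
Σᶠ-comm (ℕ.suc n) m f =
  trans (cong (Σᶠ m (f zero) +_) (Σᶠ-comm n m (λ i → f (suc i)))) (sym (Σᶠ-distrib-+ m _ _))

Σᶠ-++ : ∀ n m (f : Vector ℚ (n ℕ.+ m)) → Σᶠ (n ℕ.+ m) f ≡ Σᶠ n (take n f) + Σᶠ m (drop n f)
Σᶠ-++ ℕ.zero    m f = sym (+-identityˡ _)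
Σᶠ-++ (ℕ.suc n) m f =
  trans (cong (f zero +_) (Σᶠ-++ n m (λ i → f (suc i)))) (sym (+-assoc (f zero) (Σᶠ n _) (Σᶠ m _)))

Σᶠ-δ : ∀ n (v : Fin n) (f : Vector ℚ n) → Σᶠ n (λ j → mask ⌊ j ≟ v ⌋ (f j)) ≡ f v
Σᶠ-δ (ℕ.suc n) zero    f = trans (cong (f zero +_) (Σᶠ-zero n)) (+-identityʳ _)
Σᶠ-δ (ℕ.suc n) (suc v) f = begin
  0ℚ + Σᶠ n (λ j → mask ⌊ suc j ≟ suc v ⌋ (f (suc j)))  ≡⟨ +-identityˡ _ ⟩
  Σᶠ n (λ j → mask ⌊ suc j ≟ suc v ⌋ (f (suc j)))
    ≡⟨ Σᶠ-cong n (λ j → cong (λ e → mask e (f (suc j))) (⌊⌋-map′ _ _ (j ≟ v))) ⟩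
  Σᶠ n (λ j → mask ⌊ j ≟ v ⌋ (f (suc j)))               ≡⟨ Σᶠ-δ n v (λ j → f (suc j)) ⟩
  f (suc v)                                            ∎

Σᶠ-arc : ∀ n p (v : Fin n) (f : Vector ℚ n) → Σᶠ n (λ j → mask (p ∧ ⌊ j ≟ v ⌋) (f j)) ≡ mask p (f v)
Σᶠ-arc n true  v f = Σᶠ-δ n v f
Σᶠ-arc n false v f = Σᶠ-zero n

mask-*ˡ : ∀ p c r → mask p (c * r) ≡ c * mask p r
mask-*ˡ true  c r = refl
mask-*ˡ false c r = sym (*-zeroʳ c)

*-mask-swap : ∀ p a b → a * mask p b ≡ b * mask p a
*-mask-swap true  a b = *-comm a b
*-mask-swap false a b = trans (*-zeroʳ a) (sym (*-zeroʳ b))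

mask-∧-not : ∀ p q r → (q ≡ true → p ≡ true) → mask (p ∧ not q) r + mask q r ≡ mask p r
mask-∧-not true  true  r _   = +-identityˡ r
mask-∧-not true  false r _   = +-identityʳ r
mask-∧-not false false r _   = +-identityˡ 0ℚ
mask-∧-not false true  r q⇒p with () ← q⇒p refl

Σᶠ-*-δ : ∀ n (x : Vector ℚ n) (u : Fin n) c → Σᶠ n (λ i → x i * mask ⌊ i ≟ u ⌋ c) ≡ c * x u
Σᶠ-*-δ n x u c = begin
  Σᶠ n (λ i → x i * mask ⌊ i ≟ u ⌋ c)    ≡⟨ Σᶠ-cong n (λ i → *-mask-swap ⌊ i ≟ u ⌋ (x i) c) ⟩
  Σᶠ n (λ i → c * mask ⌊ i ≟ u ⌋ (x i))  ≡⟨ Σᶠ-*ˡ n c _ ⟩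
  c * Σᶠ n (λ i → mask ⌊ i ≟ u ⌋ (x i))  ≡⟨ cong (c *_) (Σᶠ-δ n u x) ⟩
  c * x u                                ∎

infix 10 _ᵀ
infix 8 _·_

_ᵀ : ∀ {n} → Digraph n → Digraph n
(G ᵀ) a b = G b a

_·_ : ∀ {n} → Digraph n → Vector ℚ n → Vector ℚ n
_·_ {n} G w a = Σᶠ n (λ b → mask (G a b) (w b))

deleteArc : ∀ {n} → Digraph n → Fin n → Fin n → Digraph n
deleteArc G u v a b = G a b ∧ not (⌊ a ≟ u ⌋ ∧ ⌊ b ≟ v ⌋)

arc-at-endpoints : ∀ {n} (G : Digraph n) {u v} → G u v ≡ true →
                   ∀ a b → (⌊ a ≟ u ⌋ ∧ ⌊ b ≟ v ⌋) ≡ true → G a b ≡ true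
arc-at-endpoints G {u} {v} Guv a b with a ≟ u | b ≟ v
... | yes refl | yes refl = λ _ → Guv
... | yes _    | no _     = λ ()
... | no _     | _        = λ ()

·-deleteArc : ∀ {n} (G : Digraph n) {u v} → G u v ≡ true →
              ∀ f a → (deleteArc G u v · f) a + mask ⌊ a ≟ u ⌋ (f v) ≡ (G · f) a
·-deleteArc {n} G {u} {v} Guv f a = begin
  (deleteArc G u v · f) a + mask ⌊ a ≟ u ⌋ (f v)
    ≡⟨ cong ((deleteArc G u v · f) a +_) (sym (Σᶠ-arc n ⌊ a ≟ u ⌋ v f)) ⟩
  (deleteArc G u v · f) a + Σᶠ n (λ b → mask (⌊ a ≟ u ⌋ ∧ ⌊ b ≟ v ⌋) (f b))
    ≡⟨ sym (Σᶠ-distrib-+ n _ _) ⟩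
  Σᶠ n (λ b → mask (deleteArc G u v a b) (f b) + mask (⌊ a ≟ u ⌋ ∧ ⌊ b ≟ v ⌋) (f b))
    ≡⟨ Σᶠ-cong n (λ b → mask-∧-not (G a b) _ (f b) (arc-at-endpoints G Guv a b)) ⟩
  (G · f) a ∎

coKer-orthogonal : ∀ {n} (G : Digraph n) {x} → InCoKer G x → ∀ f → Σᶠ n (λ a → x a * (G · f) a) ≡ 0ℚ
coKer-orthogonal {n} G {x} coG f = begin
  Σᶠ n (λ a → x a * (G · f) a)
    ≡⟨ Σᶠ-cong n (λ a → sym (Σᶠ-*ˡ n (x a) _)) ⟩
  Σᶠ n (λ a → Σᶠ n (λ b → x a * mask (G a b) (f b)))
    ≡⟨ Σᶠ-comm n n _ ⟩
  Σᶠ n (λ b → Σᶠ n (λ a → x a * mask (G a b) (f b)))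
    ≡⟨ Σᶠ-cong n (λ b → Σᶠ-cong n (λ a → *-mask-swap (G a b) (x a) (f b))) ⟩
  Σᶠ n (λ b → Σᶠ n (λ a → f b * mask (G a b) (x a)))
    ≡⟨ Σᶠ-cong n (λ b → Σᶠ-*ˡ n (f b) _) ⟩
  Σᶠ n (λ b → f b * (G ᵀ · x) b)
    ≡⟨ Σᶠ-cong n (λ b → trans (cong (f b *_) (coG b)) (*-zeroʳ (f b))) ⟩
  Σᶠ n (λ _ → 0ℚ)
    ≡⟨ Σᶠ-zero n ⟩
  0ℚ ∎

InKer-resp : ∀ {n} (G G′ : Digraph n) → (∀ a b → G a b ≡ G′ a b) → ∀ {w} → InKer G w → InKer G′ w
InKer-resp {n} G G′ G≗G′ {w} kw a =
  trans (Σᶠ-cong n (λ b → cong (λ e → mask e (w b)) (sym (G≗G′ a b)))) (kw a)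

SpannedBy-InKer-resp : ∀ {n} {G G′ : Digraph n} → (∀ a b → G a b ≡ G′ a b) →
                       ∀ {x} → SpannedBy (InKer G) x → SpannedBy (InKer G′) x
SpannedBy-InKer-resp {G = G} {G′} G≗G′ span w =
  (λ kw → proj₁ (span w) (InKer-resp G′ G (λ a b → sym (G≗G′ a b)) kw)) ,
  (λ sw → InKer-resp G G′ G≗G′ (proj₂ (span w) sw))

InSpan⇒InKer : ∀ {n} (G : Digraph n) {x w} → InKer G x → InSpan x w → InKer G w
InSpan⇒InKer {n} G {x} {w} kx (c , w≡cx) a = begin
  (G · w) a
    ≡⟨ Σᶠ-cong n (λ b → trans (cong (mask (G a b)) (w≡cx b)) (mask-*ˡ (G a b) c (x b))) ⟩
  Σᶠ n (λ b → c * mask (G a b) (x b))  ≡⟨ Σᶠ-*ˡ n c _ ⟩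
  c * (G · x) a                        ≡⟨ cong (c *_) (kx a) ⟩
  c * 0ℚ                               ≡⟨ *-zeroʳ c ⟩
  0ℚ                                   ∎

≗⇒InSpan : ∀ {n} {x w : Vector ℚ n} → (∀ i → w i ≡ x i) → InSpan x w
≗⇒InSpan w≗x = 1ℚ , λ i → trans (w≗x i) (sym (*-identityˡ _))

spannedBy-self : ∀ {n} {P : Vector ℚ n → Set} {x} → SpannedBy P x → P x
spannedBy-self {x = x} span = proj₂ (span x) (≗⇒InSpan (λ _ → refl))

InSpan-full : ∀ {n} {x x′ : Vector ℚ n} → InSpan x x′ → Full x′ → Full x
InSpan-full (c , x′≡cx) full′ i xi≡0 = full′ i (trans (x′≡cx i) (trans (cong (c *_) xi≡0) (*-zeroʳ c)))

ambiNut-spanner-full : ∀ {n} (G : Digraph n) {x} → AmbiNut G → SpannedBy (InKer G) x → Full x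
ambiNut-spanner-full G (_ , x′ , full′ , span′ , _) span =
  InSpan-full (proj₁ (span x′) (spannedBy-self span′)) full′

++-full : ∀ {n m} {x : Vector ℚ n} {y : Vector ℚ m} → Full x → Full y → Full (x ++ y)
++-full {x = x} {y} fx fy = ↑-elim
  (λ i e → fx i (trans (sym (lookup-++ˡ x y i)) e))
  (λ j e → fy j (trans (sym (lookup-++ʳ x y j)) e))

InSpan-++ : ∀ {n m} {x : Vector ℚ n} {y : Vector ℚ m} {w} c →
            (∀ i → w (i ↑ˡ m) ≡ c * x i) → (∀ j → w (n ↑ʳ j) ≡ c * y j) → InSpan (x ++ y) w
InSpan-++ {x = x} {y} c wx wy = c , ↑-elim
  (λ i → trans (wx i) (cong (c *_) (sym (lookup-++ˡ x y i))))
  (λ j → trans (wy j) (cong (c *_) (sym (lookup-++ʳ x y j))))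

crossOver-ᵀ : ∀ {n m} (G : Digraph n) u v (H : Digraph m) s t a b →
              crossOver (G ᵀ) v u (H ᵀ) t s a b ≡ (crossOver G u v H s t ᵀ) a b
crossOver-ᵀ {n} G u v H s t a b with splitAt n a | splitAt n b
... | inj₁ i | inj₁ j = cong (λ q → G j i ∧ not q) (∧-comm ⌊ i ≟ v ⌋ ⌊ j ≟ u ⌋)
... | inj₁ i | inj₂ j = ∧-comm ⌊ i ≟ v ⌋ ⌊ j ≟ s ⌋
... | inj₂ i | inj₁ j = ∧-comm ⌊ i ≟ t ⌋ ⌊ j ≟ u ⌋
... | inj₂ i | inj₂ j = cong (λ q → H j i ∧ not q) (∧-comm ⌊ i ≟ t ⌋ ⌊ j ≟ s ⌋)

module CrossOver {n m} (G : Digraph n) (u v : Fin n) (H : Digraph m) (s t : Fin m) where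

  K : Digraph (n ℕ.+ m)
  K = crossOver G u v H s t

  ↑ˡ-↑ˡ : ∀ i j → K (i ↑ˡ m) (j ↑ˡ m) ≡ deleteArc G u v i j
  ↑ˡ-↑ˡ i j rewrite splitAt-↑ˡ n i m | splitAt-↑ˡ n j m = refl

  ↑ˡ-↑ʳ : ∀ i j → K (i ↑ˡ m) (n ↑ʳ j) ≡ (⌊ i ≟ u ⌋ ∧ ⌊ j ≟ t ⌋)
  ↑ˡ-↑ʳ i j rewrite splitAt-↑ˡ n i m | splitAt-↑ʳ n m j = refl

  ↑ʳ-↑ˡ : ∀ i j → K (n ↑ʳ i) (j ↑ˡ m) ≡ (⌊ i ≟ s ⌋ ∧ ⌊ j ≟ v ⌋)
  ↑ʳ-↑ˡ i j rewrite splitAt-↑ʳ n m i | splitAt-↑ˡ n j m = refl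

  ↑ʳ-↑ʳ : ∀ i j → K (n ↑ʳ i) (n ↑ʳ j) ≡ deleteArc H s t i j
  ↑ʳ-↑ʳ i j rewrite splitAt-↑ʳ n m i | splitAt-↑ʳ n m j = refl

  ·-↑ˡ-blocks : ∀ w i → (K · w) (i ↑ˡ m) ≡ (deleteArc G u v · take n w) i + mask ⌊ i ≟ u ⌋ (w (n ↑ʳ t))
  ·-↑ˡ-blocks w i = trans (Σᶠ-++ n m _) (cong₂ _+_
    (Σᶠ-cong n (λ j → cong (λ e → mask e (w (j ↑ˡ m))) (↑ˡ-↑ˡ i j)))
    (trans (Σᶠ-cong m (λ j → cong (λ e → mask e (w (n ↑ʳ j))) (↑ˡ-↑ʳ i j)))
           (Σᶠ-arc m ⌊ i ≟ u ⌋ t (drop n w))))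

  ·-↑ʳ-blocks : ∀ w j → (K · w) (n ↑ʳ j) ≡ mask ⌊ j ≟ s ⌋ (w (v ↑ˡ m)) + (deleteArc H s t · drop n w) j
  ·-↑ʳ-blocks w j = trans (Σᶠ-++ n m _) (cong₂ _+_
    (trans (Σᶠ-cong n (λ i → cong (λ e → mask e (w (i ↑ˡ m))) (↑ʳ-↑ˡ j i)))
           (Σᶠ-arc n ⌊ j ≟ s ⌋ v (take n w)))
    (Σᶠ-cong m (λ i → cong (λ e → mask e (w (n ↑ʳ i))) (↑ʳ-↑ʳ j i))))

  Balanced : Vector ℚ (n ℕ.+ m) → Set
  Balanced w = w (v ↑ˡ m) ≡ w (n ↑ʳ t)

  module _ (Guv : G u v ≡ true) (Hst : H s t ≡ true) where

    ·-↑ˡ : ∀ w i → (K · w) (i ↑ˡ m) + mask ⌊ i ≟ u ⌋ (w (v ↑ˡ m))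
                 ≡ (G · take n w) i + mask ⌊ i ≟ u ⌋ (w (n ↑ʳ t))
    ·-↑ˡ w i = begin
      (K · w) (i ↑ˡ m) + mask ⌊ i ≟ u ⌋ (w (v ↑ˡ m))
        ≡⟨ cong (_+ mask ⌊ i ≟ u ⌋ (w (v ↑ˡ m))) (·-↑ˡ-blocks w i) ⟩
      ((deleteArc G u v · take n w) i + mask ⌊ i ≟ u ⌋ (w (n ↑ʳ t))) + mask ⌊ i ≟ u ⌋ (w (v ↑ˡ m))
        ≡⟨ xy∙z≈xz∙y ((deleteArc G u v · take n w) i) _ _ ⟩
      ((deleteArc G u v · take n w) i + mask ⌊ i ≟ u ⌋ (w (v ↑ˡ m))) + mask ⌊ i ≟ u ⌋ (w (n ↑ʳ t))
        ≡⟨ cong (_+ mask ⌊ i ≟ u ⌋ (w (n ↑ʳ t))) (·-deleteArc G Guv (take n w) i) ⟩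
      (G · take n w) i + mask ⌊ i ≟ u ⌋ (w (n ↑ʳ t)) ∎

    ·-↑ʳ : ∀ w j → (K · w) (n ↑ʳ j) + mask ⌊ j ≟ s ⌋ (w (n ↑ʳ t))
                 ≡ (H · drop n w) j + mask ⌊ j ≟ s ⌋ (w (v ↑ˡ m))
    ·-↑ʳ w j = begin
      (K · w) (n ↑ʳ j) + mask ⌊ j ≟ s ⌋ (w (n ↑ʳ t))
        ≡⟨ cong (_+ mask ⌊ j ≟ s ⌋ (w (n ↑ʳ t))) (·-↑ʳ-blocks w j) ⟩
      (mask ⌊ j ≟ s ⌋ (w (v ↑ˡ m)) + (deleteArc H s t · drop n w) j) + mask ⌊ j ≟ s ⌋ (w (n ↑ʳ t))
        ≡⟨ xy∙z≈yz∙x (mask ⌊ j ≟ s ⌋ (w (v ↑ˡ m))) _ _ ⟩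
      ((deleteArc H s t · drop n w) j + mask ⌊ j ≟ s ⌋ (w (n ↑ʳ t))) + mask ⌊ j ≟ s ⌋ (w (v ↑ˡ m))
        ≡⟨ cong (_+ mask ⌊ j ≟ s ⌋ (w (v ↑ˡ m))) (·-deleteArc H Hst (drop n w) j) ⟩
      (H · drop n w) j + mask ⌊ j ≟ s ⌋ (w (v ↑ˡ m)) ∎

    ker⇔ : ∀ {w} → Balanced w → InKer K w ⇔ (InKer G (take n w) × InKer H (drop n w))
    ker⇔ {w} bal = mk⇔
      (λ kw → (λ i → trans (sym (·-↑ˡ-bal i)) (kw (i ↑ˡ m))) ,
              (λ j → trans (sym (·-↑ʳ-bal j)) (kw (n ↑ʳ j))))
      (λ (kG , kH) → ↑-elim (λ i → trans (·-↑ˡ-bal i) (kG i)) (λ j → trans (·-↑ʳ-bal j) (kH j)))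
      where
      ·-↑ˡ-bal : ∀ i → (K · w) (i ↑ˡ m) ≡ (G · take n w) i
      ·-↑ˡ-bal i = ∙-cancelʳ _ _ _
        (trans (cong (λ q → (K · w) (i ↑ˡ m) + mask ⌊ i ≟ u ⌋ q) (sym bal)) (·-↑ˡ w i))
      ·-↑ʳ-bal : ∀ j → (K · w) (n ↑ʳ j) ≡ (H · drop n w) j
      ·-↑ʳ-bal j = ∙-cancelʳ _ _ _
        (trans (cong (λ q → (K · w) (n ↑ʳ j) + mask ⌊ j ≟ s ⌋ q) bal) (·-↑ʳ w j))

    ker-balanced : ∀ {x w} → InCoKer G x → x u ≢ 0ℚ → InKer K w → Balanced w
    ker-balanced {x} {w} coG xu≢0 kw = *-cancelʳ-≢0 (x u) xu≢0 (begin
      w (v ↑ˡ m) * x u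
        ≡⟨ sym (Σᶠ-*-δ n x u _) ⟩
      Σᶠ n (λ i → x i * mask ⌊ i ≟ u ⌋ (w (v ↑ˡ m)))
        ≡⟨ Σᶠ-cong n (λ i → trans (cong (x i *_) (row i)) (*-distribˡ-+ (x i) _ _)) ⟩
      Σᶠ n (λ i → x i * (G · take n w) i + x i * mask ⌊ i ≟ u ⌋ (w (n ↑ʳ t)))
        ≡⟨ Σᶠ-distrib-+ n _ _ ⟩
      Σᶠ n (λ i → x i * (G · take n w) i) + Σᶠ n (λ i → x i * mask ⌊ i ≟ u ⌋ (w (n ↑ʳ t)))
        ≡⟨ cong₂ _+_ (coKer-orthogonal G coG (take n w)) (Σᶠ-*-δ n x u _) ⟩
      0ℚ + w (n ↑ʳ t) * x u
        ≡⟨ +-identityˡ _ ⟩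
      w (n ↑ʳ t) * x u ∎)
      where
      row : ∀ i → mask ⌊ i ≟ u ⌋ (w (v ↑ˡ m)) ≡ (G · take n w) i + mask ⌊ i ≟ u ⌋ (w (n ↑ʳ t))
      row i = trans (sym (+-identityˡ _)) (trans (cong (_+ _) (sym (kw (i ↑ˡ m)))) (·-↑ˡ w i))

    ker-spannedBy : ∀ {x y} → SpannedBy (InKer G) x → InCoKer G x → Full x →
                    SpannedBy (InKer H) y → x v ≡ y t → SpannedBy (InKer K) (x ++ y)
    ker-spannedBy {x} {y} spanG coG fx spanH xv≡yt w = ker⇒span , span⇒ker
      where
      ker⇒span : InKer K w → InSpan (x ++ y) w
      ker⇒span kw = combine (proj₁ (spanG (take n w)) (proj₁ kGH)) (proj₁ (spanH (drop n w)) (proj₂ kGH))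
        where
        bal : Balanced w
        bal = ker-balanced coG (fx u) kw
        kGH : InKer G (take n w) × InKer H (drop n w)
        kGH = Equivalence.to (ker⇔ bal) kw
        combine : InSpan x (take n w) → InSpan y (drop n w) → InSpan (x ++ y) w
        combine (c , wx) (d , wy) = InSpan-++ c wx (λ j → trans (wy j) (cong (_* y j) (sym c≡d)))
          where
          c≡d : c ≡ d
          c≡d = *-cancelʳ-≢0 (x v) (fx v) (begin
            c * x v     ≡⟨ sym (wx v) ⟩
            w (v ↑ˡ m)  ≡⟨ bal ⟩
            w (n ↑ʳ t)  ≡⟨ wy t ⟩
            d * y t     ≡⟨ cong (d *_) (sym xv≡yt) ⟩
            d * x v     ∎)
      span⇒ker : InSpan (x ++ y) w → InKer K w
      span⇒ker = InSpan⇒InKer K (Equivalence.from (ker⇔ bal) (kG , kH))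
        where
        bal : Balanced (x ++ y)
        bal = trans (lookup-++ˡ x y v) (trans xv≡yt (sym (lookup-++ʳ x y t)))
        kG : InKer G (take n (x ++ y))
        kG = InSpan⇒InKer G (spannedBy-self spanG) (≗⇒InSpan (lookup-++ˡ x y))
        kH : InKer H (drop n (x ++ y))
        kH = InSpan⇒InKer H (spannedBy-self spanH) (≗⇒InSpan (lookup-++ʳ x y))

theorem30 : ∀ {n m} (G : Digraph n) (H : Digraph m) (x : Fin n → ℚ) (y : Fin m → ℚ)
            → AmbiNut G → SpannedBy (InKer G) x → SpannedBy (InCoKer G) x
            → AmbiNut H → SpannedBy (InKer H) y → SpannedBy (InCoKer H) y
            → (u v : Fin n) (s t : Fin m)
            → G u v ≡ true → H s t ≡ true
            → x u ≡ y s → x v ≡ y t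
            → AmbiNut (crossOver G u v H s t)
theorem30 {n} {m} G H x y ambiG kerG coKerG ambiH kerH coKerH u v s t Guv Hst xu≡ys xv≡yt =
  ≤-trans (proj₁ ambiG) (m≤m+n n m) , x ++ y , ++-full fx fy , ker , coKer
  where
  fx : Full x
  fx = ambiNut-spanner-full G ambiG kerG
  fy : Full y
  fy = ambiNut-spanner-full H ambiH kerH
  ker : SpannedBy (InKer (crossOver G u v H s t)) (x ++ y)
  ker = CrossOver.ker-spannedBy G u v H s t Guv Hst kerG (spannedBy-self coKerG) fx kerH xv≡yt
  coKer : SpannedBy (InCoKer (crossOver G u v H s t)) (x ++ y)
  coKer = SpannedBy-InKer-resp (crossOver-ᵀ G u v H s t)
    (CrossOver.ker-spannedBy (G ᵀ) v u (H ᵀ) t s Guv Hst coKerG (spannedBy-self kerG) fx coKerH xu≡ys)
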